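{- Let $m,n$ be coprime positive integers and let $P\in\mathcal F_{m,n}$. Then a set $R=\{r_0,\dots,r_{m+n-1}\}$ is the rank set of $P$ (computed in $\mathcal F_{m,n}$) if and only if it is the rank set of the transpose $P^T\in\mathcal F_{n,m}$ (computed in $\mathcal F_{n,m}$); that is, $r(P)=r(P^T)$. The same holds when restricted to nonnegative rank sets and Dyck paths: $R$ is the rank set of an $(m,n)$-Dyck path $D$ if and only if it is the rank set of the $(n,m)$-Dyck path $D^T$.
   Context: A path is a word $P=p_1\cdots p_k$ in the letters $N$ (unit step $(0,1)$) and $E$ (unit step $(1,0)$), drawn as the sequence of lattice points $P_0=(0,0),P_1,\dots,P_k$ with $P_i-P_{i-1}=(0,1)$ if $p_i=N$ and $(1,0)$ if $p_i=E$. $\mathcal F_{m,n}$ is the set of paths from $(0,0)$ to $(m,n)$. An $(m,n)$-Dyck path is a path in $\mathcal F_{m,n}$ that never goes below the line $y=\frac nm x$. In the $(m,n)$ setting the rank of a lattice point $(a,b)$ is $r(a,b)=mb-na$, and the rank set of $P\in\mathcal F_{m,n}$ is $r(P)=\{r(P_0),\dots,r(P_{m+n-1})\}$ (for coprime $m,n$ these are $m+n$ distinct integers). For a path $Q$ in $\mathcal F_{n,m}$ ranks are computed as $r(a,b)=nb-ma$. The transpose $P^T$ of $P$ is obtained by reversing the word $P$ and interchanging the letters $N$ and $E$; if $P\in\mathcal F_{m,n}$ then $P^T\in\mathcal F_{n,m}$. -}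

module Defs where

open import Data.Nat using (ℕ; zero; suc; _*_; _≤_)
open import Data.Integer using (ℤ; +_; _-_)
open import Data.List using (List; []; _∷_; map; reverse)
open import Data.List.Relation.Unary.All using (All)
open import Data.Product using (_×_; _,_)
open import Relation.Binary.PropositionalEquality using (_≡_)

-- Unit steps: N = (0,1), E = (1,0)
data Step : Set where
  N E : Step

#E : List Step → ℕ
#E []      = 0
#E (E ∷ p) = suc (#E p)
#E (N ∷ p) = #E p

#N : List Step → ℕ
#N []      = 0
#N (N ∷ p) = suc (#N p)
#N (E ∷ p) = #N p

InF : ℕ → ℕ → List Step → Set
InF m n P = (#E P ≡ m) × (#N P ≡ n)

move : ℕ × ℕ → Step → ℕ × ℕ
move (a , b) N = (a , suc b)
move (a , b) E = (suc a , b)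

-- lattice points P_0, ..., P_{k-1} (all but the final one), starting at the given point
pointsFrom : ℕ × ℕ → List Step → List (ℕ × ℕ)
pointsFrom x []      = []
pointsFrom x (s ∷ p) = x ∷ pointsFrom (move x s) p

allPointsFrom : ℕ × ℕ → List Step → List (ℕ × ℕ)
allPointsFrom x []      = x ∷ []
allPointsFrom x (s ∷ p) = x ∷ allPointsFrom (move x s) p

rank : ℕ → ℕ → ℕ × ℕ → ℤ
rank m n (a , b) = + (m * b) - + (n * a)

-- rank set r(P) = {r(P_0), ..., r(P_{m+n-1})}, as a list (membership = set membership)
rankSet : ℕ → ℕ → List Step → List ℤ
rankSet m n P = map (rank m n) (pointsFrom (0 , 0) P)

swapStep : Step → Step
swapStep N = E
swapStep E = N

transpose : List Step → List Step
transpose P = map swapStep (reverse P)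

-- (m,n)-Dyck path: in 𝓕_{m,n} and never below y = (n/m) x, i.e. n a ≤ m b at every lattice point
IsDyck : ℕ → ℕ → List Step → Set
IsDyck m n P = InF m n P × All (λ { (a , b) → n * a ≤ m * b }) (allPointsFrom (0 , 0) P)

module Submission where

-- Let P ∈ 𝓕_{m,n} have lattice points P_0, …, P_k.  Transposing
-- reflects the path through the anti-diagonal of the m × n box: the i-th point
-- (a , b) of P corresponds to the (k-i)-th point (a' , b') = (n - b , m - a) of
-- Pᵀ, which we record subtraction-free as the relation  Mirror m n.
-- Since  m(b + a') = mn = n(a + b'),  mirrored points have the same rank
-- (one computed in the (m,n) setting, the other in the (n,m) setting), and one
-- lies on or above its diagonal iff the other does.
--
-- Ranks and the Dyck condition are then
-- transported along this correspondence in one direction (rankSet-transpose,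
-- isDyck-transpose); the converse directions follow by applying the same
-- results to Pᵀ, because transposition is an involution.  Rank sets omit the
-- final point, but P_0 and P_k both have rank 0, so nothing is lost by
-- working with all lattice points.

open import Defs
open import Data.Nat using (ℕ; _<_; _+_; _*_; _≤_)
open import Data.Nat.Coprimality using (Coprime)
open import Data.Integer using (ℤ)
open import Data.List using (List)
open import Data.List.Membership.Propositional using (_∈_)
open import Data.Product using (_×_)
open import Function.Bundles using (_⇔_)

import Data.Nat.Properties as ℕ
import Data.Integer as ℤ
import Data.Integer.Properties as ℤ
open import Data.Integer.Tactic.RingSolver using (solve-∀)
open import Data.List using ([]; _∷_; _++_; [_]; map; reverse; reverseAcc)
open import Data.List.Properties using (map-++; unfold-reverse; reverse-++; reverse-map; reverse-involutive; map-∘)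
open import Data.List.Membership.Propositional.Properties using (∈-++⁺ˡ; ∈-++⁻; ∈-map⁺)
open import Data.List.Relation.Unary.Any using (Any; here; there)
import Data.List.Relation.Unary.Any.Properties as Any
open import Data.List.Relation.Unary.All using (All; []; _∷_)
import Data.List.Relation.Unary.All as All
open import Data.List.Relation.Binary.Pointwise using (Pointwise; []; _∷_)
open import Data.Product using (_,_; proj₁; proj₂)
open import Data.Sum using (inj₁; inj₂)
open import Function using (_∘_)
open import Function.Bundles using (mk⇔)
open import Relation.Nullary using (¬_)
open import Relation.Binary.PropositionalEquality
  using (_≡_; refl; sym; trans; cong; cong₂; subst; module ≡-Reasoning)

Pt : Set
Pt = ℕ × ℕ

Any-transport : ∀ {A B : Set} {R : A → B → Set} {P : A → Set} {Q : B → Set} →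
  (∀ {x y} → R x y → P x → Q y) →
  ∀ {xs ys} → Pointwise R xs ys → Any P xs → Any Q ys
Any-transport f (r ∷ _)  (here p)  = here (f r p)
Any-transport f (_ ∷ rs) (there i) = there (Any-transport f rs i)

All-transport : ∀ {A B : Set} {R : A → B → Set} {P : A → Set} {Q : B → Set} →
  (∀ {x y} → R x y → P x → Q y) →
  ∀ {xs ys} → Pointwise R xs ys → All P xs → All Q ys
All-transport f []       []       = []
All-transport f (r ∷ rs) (p ∷ ps) = f r p ∷ All-transport f rs ps

All-reverse⁻ : ∀ {A : Set} {P : A → Set} xs → All P (reverse xs) → All P xs
All-reverse⁻ xs ps = All.tabulate (λ i → All.lookup ps (Any.reverse⁺ i))

endFrom : Pt → List Step → Pt
endFrom x []      = x
endFrom x (s ∷ p) = endFrom (move x s) p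

endFrom-counts : ∀ a b P → endFrom (a , b) P ≡ (a + #E P , b + #N P)
endFrom-counts a b []      = cong₂ _,_ (sym (ℕ.+-identityʳ a)) (sym (ℕ.+-identityʳ b))
endFrom-counts a b (N ∷ P) = trans (endFrom-counts a (1 + b) P) (cong (a + #E P ,_) (sym (ℕ.+-suc b (#N P))))
endFrom-counts a b (E ∷ P) = trans (endFrom-counts (1 + a) b P) (cong (_, b + #N P) (sym (ℕ.+-suc a (#E P))))

endFrom-snoc : ∀ x Q t → endFrom x (Q ++ [ t ]) ≡ move (endFrom x Q) t
endFrom-snoc x []      t = refl
endFrom-snoc x (s ∷ Q) t = endFrom-snoc (move x s) Q t

allPoints-split : ∀ x P → allPointsFrom x P ≡ pointsFrom x P ++ [ endFrom x P ]
allPoints-split x []      = refl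
allPoints-split x (s ∷ P) = cong (x ∷_) (allPoints-split (move x s) P)

values-split : ∀ {A : Set} (f : Pt → A) x P →
  map f (allPointsFrom x P) ≡ map f (pointsFrom x P) ++ [ f (endFrom x P) ]
values-split f x P = trans (cong (map f) (allPoints-split x P)) (map-++ f (pointsFrom x P) [ endFrom x P ])

reverse-allPoints-snoc : ∀ y Q t →
  reverse (allPointsFrom y (Q ++ [ t ])) ≡ endFrom y (Q ++ [ t ]) ∷ reverse (allPointsFrom y Q)
reverse-allPoints-snoc y Q t = begin
    reverse (allPointsFrom y (Q ++ [ t ]))
  ≡⟨ cong reverse (allPoints-split y (Q ++ [ t ])) ⟩
    reverse (pointsFrom y (Q ++ [ t ]) ++ [ endFrom y (Q ++ [ t ]) ])
  ≡⟨ reverse-++ (pointsFrom y (Q ++ [ t ])) _ ⟩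
    endFrom y (Q ++ [ t ]) ∷ reverse (pointsFrom y (Q ++ [ t ]))
  ≡⟨ cong (λ zs → endFrom y (Q ++ [ t ]) ∷ reverse zs) (pointsFrom-snoc y Q) ⟩
    endFrom y (Q ++ [ t ]) ∷ reverse (allPointsFrom y Q)
  ∎
  where
  open ≡-Reasoning
  pointsFrom-snoc : ∀ y Q → pointsFrom y (Q ++ [ t ]) ≡ allPointsFrom y Q
  pointsFrom-snoc y []      = refl
  pointsFrom-snoc y (s ∷ Q) = cong (y ∷_) (pointsFrom-snoc (move y s) Q)

transpose-∷ : ∀ s P → transpose (s ∷ P) ≡ transpose P ++ [ swapStep s ]
transpose-∷ s P = trans (cong (map swapStep) (unfold-reverse s P)) (map-++ swapStep (reverse P) [ s ])

transpose-involutive : ∀ P → transpose (transpose P) ≡ P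
transpose-involutive P = begin
    map swapStep (reverse (map swapStep (reverse P)))
  ≡⟨ cong (map swapStep) (sym (reverse-map swapStep (reverse P))) ⟩
    map swapStep (map swapStep (reverse (reverse P)))
  ≡⟨ sym (map-∘ (reverse (reverse P))) ⟩
    map (swapStep ∘ swapStep) (reverse (reverse P))
  ≡⟨ cong (map (swapStep ∘ swapStep)) (reverse-involutive P) ⟩
    map (swapStep ∘ swapStep) P
  ≡⟨ map-swap-swap P ⟩
    P
  ∎
  where
  open ≡-Reasoning
  map-swap-swap : ∀ P → map (swapStep ∘ swapStep) P ≡ P
  map-swap-swap []      = refl
  map-swap-swap (N ∷ P) = cong (N ∷_) (map-swap-swap P)
  map-swap-swap (E ∷ P) = cong (E ∷_) (map-swap-swap P)

#E-swap : ∀ P → #E (map swapStep P) ≡ #N P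
#E-swap []      = refl
#E-swap (N ∷ P) = cong ℕ.suc (#E-swap P)
#E-swap (E ∷ P) = #E-swap P

#N-swap : ∀ P → #N (map swapStep P) ≡ #E P
#N-swap []      = refl
#N-swap (N ∷ P) = #N-swap P
#N-swap (E ∷ P) = cong ℕ.suc (#N-swap P)

#E-reverseAcc : ∀ acc P → #E (reverseAcc acc P) ≡ #E acc + #E P
#E-reverseAcc acc []      = sym (ℕ.+-identityʳ (#E acc))
#E-reverseAcc acc (N ∷ P) = #E-reverseAcc (N ∷ acc) P
#E-reverseAcc acc (E ∷ P) = trans (#E-reverseAcc (E ∷ acc) P) (sym (ℕ.+-suc (#E acc) (#E P)))

#N-reverseAcc : ∀ acc P → #N (reverseAcc acc P) ≡ #N acc + #N P
#N-reverseAcc acc []      = sym (ℕ.+-identityʳ (#N acc))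
#N-reverseAcc acc (N ∷ P) = trans (#N-reverseAcc (N ∷ acc) P) (sym (ℕ.+-suc (#N acc) (#N P)))
#N-reverseAcc acc (E ∷ P) = #N-reverseAcc (E ∷ acc) P

InF-transpose : ∀ {m n} P → InF m n P → InF n m (transpose P)
InF-transpose P (#E≡m , #N≡n) =
  trans (#E-swap (reverse P)) (trans (#N-reverseAcc [] P) #N≡n) ,
  trans (#N-swap (reverse P)) (trans (#E-reverseAcc [] P) #E≡m)

InF-nonempty : ∀ {m n} P → 0 < m → InF m n P → ¬ P ≡ []
InF-nonempty [] () (refl , _) refl

-- (a , b) and (a' , b') are reflections of each other through the
-- anti-diagonal of the A × B box: a' = B - b and b' = A - a.
Mirror : ℕ → ℕ → Pt → Pt → Set
Mirror A B (a , b) (a' , b') = (a + b' ≡ A) × (b + a' ≡ B)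

Mirror-step : ∀ {A B} x e s → Mirror A B x (move e (swapStep s)) → Mirror A B (move x s) e
Mirror-step (a , b) (a' , b') N (h₁ , h₂) = h₁ , trans (sym (ℕ.+-suc b a')) h₂
Mirror-step (a , b) (a' , b') E (h₁ , h₂) = trans (sym (ℕ.+-suc a b')) h₁ , h₂

mirror-points-from : ∀ {A B} P x y → Mirror A B x (endFrom y (transpose P)) →
  Pointwise (Mirror A B) (allPointsFrom x P) (reverse (allPointsFrom y (transpose P)))
mirror-points-from []      x y h = h ∷ []
mirror-points-from {A} {B} (s ∷ P) x y h =
  subst (Pointwise (Mirror A B) (allPointsFrom x (s ∷ P))) (sym backwards)
    (h′ ∷ mirror-points-from P (move x s) y (Mirror-step x _ s (subst (Mirror A B x) end h′)))
  where
  Q : List Step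
  Q = transpose P
  t : Step
  t = swapStep s
  h′ : Mirror A B x (endFrom y (Q ++ [ t ]))
  h′ = subst (Mirror A B x ∘ endFrom y) (transpose-∷ s P) h
  end : endFrom y (Q ++ [ t ]) ≡ move (endFrom y Q) t
  end = endFrom-snoc y Q t
  backwards : reverse (allPointsFrom y (transpose (s ∷ P))) ≡ endFrom y (Q ++ [ t ]) ∷ reverse (allPointsFrom y Q)
  backwards = trans (cong (reverse ∘ allPointsFrom y) (transpose-∷ s P)) (reverse-allPoints-snoc y Q t)

-- For P ∈ 𝓕_{m,n}: P_i mirrors the (k-i)-th point of Pᵀ, since P_0 = (0,0)
-- mirrors the endpoint (n , m) of Pᵀ.
mirror-points : ∀ {m n} P → InF m n P →
  Pointwise (Mirror m n) (allPointsFrom (0 , 0) P) (reverse (allPointsFrom (0 , 0) (transpose P)))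
mirror-points P inF = mirror-points-from P (0 , 0) (0 , 0) start
  where
  start : Mirror _ _ (0 , 0) (endFrom (0 , 0) (transpose P))
  start rewrite endFrom-counts 0 0 (transpose P) = proj₂ (InF-transpose P inF) , proj₁ (InF-transpose P inF)

mirror-balance : ∀ {m n a b a' b'} → Mirror m n (a , b) (a' , b') →
  n * a + n * b' ≡ m * b + m * a'
mirror-balance {m} {n} {a} {b} {a'} {b'} (h₁ , h₂) = begin
  n * a + n * b'  ≡⟨ sym (ℕ.*-distribˡ-+ n a b') ⟩
  n * (a + b')    ≡⟨ cong (n *_) h₁ ⟩
  n * m           ≡⟨ ℕ.*-comm n m ⟩
  m * n           ≡⟨ cong (m *_) (sym h₂) ⟩
  m * (b + a')    ≡⟨ ℕ.*-distribˡ-+ m b a' ⟩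
  m * b + m * a'  ∎
  where open ≡-Reasoning

difference-cross : ∀ x y u v → x + v ≡ u + y → ℤ.+ x ℤ.- ℤ.+ y ≡ ℤ.+ u ℤ.- ℤ.+ v
difference-cross x y u v eq = begin
    ℤ.+ x ℤ.- ℤ.+ y
  ≡⟨ regroup (ℤ.+ x) (ℤ.+ y) (ℤ.+ u) (ℤ.+ v) ⟩
    (ℤ.+ x ℤ.+ ℤ.+ v) ℤ.- (ℤ.+ u ℤ.+ ℤ.+ y) ℤ.+ (ℤ.+ u ℤ.- ℤ.+ v)
  ≡⟨ cong (λ z → z ℤ.- (ℤ.+ u ℤ.+ ℤ.+ y) ℤ.+ (ℤ.+ u ℤ.- ℤ.+ v)) cross ⟩
    (ℤ.+ u ℤ.+ ℤ.+ y) ℤ.- (ℤ.+ u ℤ.+ ℤ.+ y) ℤ.+ (ℤ.+ u ℤ.- ℤ.+ v)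
  ≡⟨ cancel (ℤ.+ u ℤ.+ ℤ.+ y) (ℤ.+ u ℤ.- ℤ.+ v) ⟩
    ℤ.+ u ℤ.- ℤ.+ v
  ∎
  where
  open ≡-Reasoning
  cross : ℤ.+ x ℤ.+ ℤ.+ v ≡ ℤ.+ u ℤ.+ ℤ.+ y
  cross = trans (sym (ℤ.pos-+ x v)) (trans (cong ℤ.+_ eq) (ℤ.pos-+ u y))
  regroup : ∀ (x y u v : ℤ) → x ℤ.- y ≡ (x ℤ.+ v) ℤ.- (u ℤ.+ y) ℤ.+ (u ℤ.- v)
  regroup = solve-∀
  cancel : ∀ (s t : ℤ) → s ℤ.- s ℤ.+ t ≡ t
  cancel = solve-∀

rank-mirror : ∀ {m n} z w → Mirror m n z w → rank m n z ≡ rank n m w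
rank-mirror {m} {n} (a , b) (a' , b') h =
  difference-cross (m * b) (n * a) (n * b') (m * a')
    (trans (sym (mirror-balance h)) (ℕ.+-comm (n * a) (n * b')))

below-mirror : ∀ {m n} z w → Mirror m n z w →
  n * proj₁ z ≤ m * proj₂ z → m * proj₁ w ≤ n * proj₂ w
below-mirror {m} {n} (a , b) (a' , b') h na≤mb = ℕ.+-cancelʳ-≤ (n * a) _ _ (begin
  m * a' + n * a   ≤⟨ ℕ.+-monoʳ-≤ (m * a') na≤mb ⟩
  m * a' + m * b   ≡⟨ ℕ.+-comm (m * a') (m * b) ⟩
  m * b + m * a'   ≡⟨ sym (mirror-balance h) ⟩
  n * a + n * b'   ≡⟨ ℕ.+-comm (n * a) (n * b') ⟩
  n * b' + n * a   ∎)
  where open ℕ.≤-Reasoning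

-- A value attained at the endpoint is already attained at the start, so
-- for such f the values of f on all points and on the points before the
-- last step coincide.
closed-values : ∀ (f : Pt → ℤ) x P {r} → ¬ P ≡ [] → f (endFrom x P) ≡ f x →
  r ∈ map f (allPointsFrom x P) → r ∈ map f (pointsFrom x P)
closed-values f x P nonempty closed i with ∈-++⁻ (map f (pointsFrom x P)) (subst (_ ∈_) (values-split f x P) i)
... | inj₁ j         = j
... | inj₂ (here eq) = subst (_∈ map f (pointsFrom x P)) (sym (trans eq closed)) (∈-map⁺ f (start x P nonempty))
  where
  start : ∀ x P → ¬ P ≡ [] → x ∈ pointsFrom x P
  start x []      nonempty with () ← nonempty refl
  start x (s ∷ P) _        = here refl

rank-end : ∀ {m n} P → InF m n P → rank m n (endFrom (0 , 0) P) ≡ rank m n (0 , 0)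
rank-end {m} {n} P (#E≡m , #N≡n) rewrite endFrom-counts 0 0 P | #E≡m | #N≡n =
  begin
    ℤ.+ (m * n) ℤ.- ℤ.+ (n * m)  ≡⟨ cong (λ k → ℤ.+ (m * n) ℤ.- ℤ.+ k) (ℕ.*-comm n m) ⟩
    ℤ.+ (m * n) ℤ.- ℤ.+ (m * n)  ≡⟨ ℤ.+-inverseʳ (ℤ.+ (m * n)) ⟩
    ℤ.+ 0                         ≡⟨ cong₂ (λ i j → ℤ.+ i ℤ.- ℤ.+ j) (sym (ℕ.*-zeroʳ m)) (sym (ℕ.*-zeroʳ n)) ⟩
    ℤ.+ (m * 0) ℤ.- ℤ.+ (n * 0)  ∎
  where open ≡-Reasoning

rankSet-transpose : ∀ {m n} P → 0 < m → 0 < n → InF m n P →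
  ∀ {r} → r ∈ rankSet m n P → r ∈ rankSet n m (transpose P)
rankSet-transpose {m} {n} P m>0 n>0 inF r∈ =
  closed-values (rank n m) (0 , 0) (transpose P)
    (InF-nonempty (transpose P) n>0 inFᵀ) (rank-end (transpose P) inFᵀ)
    (Any.map⁺ (Any.reverse⁻ (Any-transport (λ {z} {w} h eq → trans eq (rank-mirror z w h))
      (mirror-points P inF) (Any.map⁻ (all-points r∈)))))
  where
  inFᵀ : InF n m (transpose P)
  inFᵀ = InF-transpose P inF
  all-points : ∀ {r} → r ∈ rankSet m n P → r ∈ map (rank m n) (allPointsFrom (0 , 0) P)
  all-points i = subst (_ ∈_) (sym (values-split (rank m n) (0 , 0) P)) (∈-++⁺ˡ i)

isDyck-transpose : ∀ {m n} P → IsDyck m n P → IsDyck n m (transpose P)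
isDyck-transpose P (inF , above) =
  InF-transpose P inF ,
  All-reverse⁻ (allPointsFrom (0 , 0) (transpose P))
    (All-transport (λ {z} {w} → below-mirror z w) (mirror-points P inF) above)

-- Lemma 2.1: r(P) = r(Pᵀ), and P is Dyck iff Pᵀ is.  Each converse is the
-- forward direction for Pᵀ, transported back along Pᵀᵀ = P.
lemma2p1 : (m n : ℕ) → 0 < m → 0 < n → Coprime m n →
    (P : List Step) → InF m n P →
    ((r : ℤ) → (r ∈ rankSet m n P) ⇔ (r ∈ rankSet n m (transpose P)))
    × (IsDyck m n P ⇔ IsDyck n m (transpose P))
lemma2p1 m n m>0 n>0 _ P inF =
  (λ r → mk⇔ (rankSet-transpose P m>0 n>0 inF) (back (λ Q → r ∈ rankSet m n Q) ∘ rankSet-transpose (transpose P) n>0 m>0 inFᵀ)) ,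
  mk⇔ (isDyck-transpose P) (back (IsDyck m n) ∘ isDyck-transpose (transpose P))
  where
  inFᵀ : InF n m (transpose P)
  inFᵀ = InF-transpose P inF
  back : ∀ (F : List Step → Set) → F (transpose (transpose P)) → F P
  back F = subst F (transpose-involutive P)
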